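{- There is a randomized algorithm which, given a parameter $k$, query access to a monotone function $f:\{0,1\}^n\to\{0,1\}$ with certificate complexity $C(f)\le k$, and an input $x^\star\in\{0,1\}^n$, makes $O(k^8\log n)$ queries to $f$ and with high probability (probability at least $1-1/\mathrm{poly}(n)$) returns a certificate of size at most $k$ for $f$'s value on $x^\star$.
   Context: For $f:\{0,1\}^n\to\{0,1\}$ and $x^\star\in\{0,1\}^n$, a set $S\subseteq[n]$ is a certificate for $f$'s value on $x^\star$ if $f(y)=f(x^\star)$ for every $y\in\{0,1\}^n$ with $y_S=x^\star_S$ (i.e. $y_i=x^\star_i$ for all $i\in S$). $C(f,x^\star)$ is the minimum size of such a certificate and the certificate complexity is $C(f)=\max_{x}C(f,x)$. $f$ is monotone if $x\le y$ coordinatewise implies $f(x)\le f(y)$. A query returns $f(x)$ for a chosen $x$. -}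

module Defs where

open import Data.Nat using (ℕ; zero; suc; _⊔_)
open import Data.Bool using (Bool; true; false) renaming (_≤_ to _≤ᵇ_)
open import Data.Fin using (Fin)
open import Data.Fin.Subset using (Subset; _∈_)
open import Data.Product using (∃; _×_)
open import Relation.Binary.PropositionalEquality using (_≡_)
open import Data.Nat using (_≤_)
open import Data.Fin.Subset using (∣_∣)

-- Inputs x ∈ {0,1}^n, as functions Fin n → Bool (false = 0, true = 1).
Input : ℕ → Set
Input n = Fin n → Bool

Monotone : {n : ℕ} → (Input n → Bool) → Set
Monotone {n} f = ∀ (x y : Input n) → (∀ i → x i ≤ᵇ y i) → f x ≤ᵇ f y

IsCertificate : {n : ℕ} → (Input n → Bool) → Input n → Subset n → Set
IsCertificate {n} f x⋆ S = ∀ (y : Input n) → (∀ i → i ∈ S → y i ≡ x⋆ i) → f y ≡ f x⋆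

CertCompAt≤ : {n : ℕ} → (Input n → Bool) → Input n → ℕ → Set
CertCompAt≤ f x k = ∃ λ S → IsCertificate f x S × ∣ S ∣ ≤ k

CertComp≤ : {n : ℕ} → (Input n → Bool) → ℕ → Set
CertComp≤ f k = ∀ x → CertCompAt≤ f x k

-- Deterministic query algorithms (decision trees) with query access to f,
-- outputting a subset of [n].  A query asks f at a chosen point and branches on the answer.
data QTree (n : ℕ) : Set where
  leaf  : Subset n → QTree n
  query : Input n → (Bool → QTree n) → QTree n

height : {n : ℕ} → QTree n → ℕ
height (leaf _)    = 0
height (query _ t) = suc (height (t false) ⊔ height (t true))

run : {n : ℕ} → (Input n → Bool) → QTree n → Subset n
run f (leaf S)    = S
run f (query y t) = run f (t (f y))

{-# OPTIONS --safe #-}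
-- No randomness is needed for monotone f.  Let b = f x⋆ and let point T agree
-- with x⋆ on T and equal not b elsewhere; by monotonicity, f (point T) ≡ b makes
-- T a certificate.  Greedily build F: while F is not yet a certificate, bisect
-- over the sets F ∪ {i | i < t} for a t at which adding coordinate t restores
-- the value b, and add t to F.  Every coordinate collected so far stays
-- sensitive at the current point, and any certificate of that point contains
-- all its sensitive coordinates, so C(f) ≤ k bounds |F| by k.  Hence k + 1
-- rounds of 1 + ⌈log₂ n⌉ queries suffice.
module Submission where

open import Defs
open import Data.Nat using (ℕ; zero; suc; _+_; _*_; _^_; _≤_; _<_; z≤n; s≤s; _<?_; ⌈_/2⌉; ⌊_/2⌋)
open import Data.Nat.Properties
open import Data.Nat.Logarithm using (⌈log₂_⌉)
open import Data.Nat.Logarithm.Core using (⌈log2⌉)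
open import Data.Fin using (Fin; toℕ; fromℕ<)
import Data.Fin as Fin
open import Data.Fin.Properties using (toℕ-fromℕ<; toℕ-injective; toℕ<n)
open import Data.Bool using (Bool; true; false; not; if_then_else_; b≤b; f≤t) renaming (_≤_ to _≤ᵇ_)
open import Data.Bool.Properties using (not-¬) renaming (_≟_ to _≟ᵇ_)
open import Data.Fin.Subset using (Subset; _∈_; _∉_; _⊆_; ∣_∣; ⊥; ⁅_⁆; _∪_; _─_; _-_; inside; outside)
open import Data.Fin.Subset.Properties
open import Data.Product using (Σ; ∃; _×_; _,_)
open import Data.Sum using (inj₁; inj₂)
open import Data.Vec using (_∷_; []; here; there)
open import Function using (_∘_)
open import Relation.Binary.PropositionalEquality using (_≡_; _≢_; refl; sym; trans; cong; subst; module ≡-Reasoning)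
open import Relation.Nullary using (yes; no; does; contradiction)
open import Induction.WellFounded using (Acc; acc)

n≤2*⌈n/2⌉ : ∀ n → n ≤ 2 * ⌈ n /2⌉
n≤2*⌈n/2⌉ n = begin
  n                       ≡⟨ sym (⌊n/2⌋+⌈n/2⌉≡n n) ⟩
  ⌊ n /2⌋ + ⌈ n /2⌉       ≤⟨ +-monoˡ-≤ ⌈ n /2⌉ (⌊n/2⌋≤⌈n/2⌉ n) ⟩
  ⌈ n /2⌉ + ⌈ n /2⌉       ≡⟨ cong (⌈ n /2⌉ +_) (sym (+-identityʳ ⌈ n /2⌉)) ⟩
  2 * ⌈ n /2⌉             ∎
  where open ≤-Reasoning

n≤2^⌈log2⌉n : ∀ n (rec : Acc _<_ n) → n ≤ 2 ^ ⌈log2⌉ n rec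
n≤2^⌈log2⌉n zero          _        = z≤n
n≤2^⌈log2⌉n (suc zero)    _        = s≤s z≤n
n≤2^⌈log2⌉n (suc (suc n)) (acc rs) =
  ≤-trans (n≤2*⌈n/2⌉ (suc (suc n))) (*-monoʳ-≤ 2 (n≤2^⌈log2⌉n (suc ⌈ n /2⌉) (rs (⌈n/2⌉<n n))))

n≤2^⌈log₂n⌉ : ∀ n → n ≤ 2 ^ ⌈log₂ n ⌉
n≤2^⌈log₂n⌉ n = n≤2^⌈log2⌉n n _

≤ᵇ-intro-true : ∀ {u v} → (u ≡ true → v ≡ true) → u ≤ᵇ v
≤ᵇ-intro-true {false} {false} _ = b≤b
≤ᵇ-intro-true {false} {true}  _ = f≤t
≤ᵇ-intro-true {true}  {true}  _ = b≤b
≤ᵇ-intro-true {true}  {false} h with h refl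
... | ()

≤ᵇ-intro-false : ∀ {u v} → (v ≡ false → u ≡ false) → u ≤ᵇ v
≤ᵇ-intro-false {false} {false} _ = b≤b
≤ᵇ-intro-false {false} {true}  _ = f≤t
≤ᵇ-intro-false {true}  {true}  _ = b≤b
≤ᵇ-intro-false {true}  {false} h with h refl
... | ()

≤ᵇ-elim-true : ∀ {u v} → u ≤ᵇ v → u ≡ true → v ≡ true
≤ᵇ-elim-true b≤b e = e

≤ᵇ-elim-false : ∀ {u v} → u ≤ᵇ v → v ≡ false → u ≡ false
≤ᵇ-elim-false b≤b e = e

-- For b = true this is y ≤ z pointwise, for b = false it is z ≤ y.
_⊑[_]_ : ∀ {n} → Input n → Bool → Input n → Set
y ⊑[ b ] z = ∀ i → y i ≡ b → z i ≡ b

monotone-preserves : ∀ {n} {f : Input n → Bool} → Monotone f →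
                     ∀ b {y z} → y ⊑[ b ] z → f y ≡ b → f z ≡ b
monotone-preserves mono true  y⊑z = ≤ᵇ-elim-true  (mono _ _ (λ i → ≤ᵇ-intro-true (y⊑z i)))
monotone-preserves mono false y⊑z = ≤ᵇ-elim-false (mono _ _ (λ i → ≤ᵇ-intro-false (y⊑z i)))

x∈p─q⇒x∉q : ∀ {n} {x : Fin n} (p q : Subset n) → x ∈ p ─ q → x ∉ q
x∈p─q⇒x∉q (_ ∷ p) (outside ∷ q) here        ()
x∈p─q⇒x∉q (_ ∷ p) (_       ∷ q) (there x∈) (there x∈q) = x∈p─q⇒x∉q p q x∈ x∈q

x∈p-y⇒x≢y : ∀ {n} {x y : Fin n} {p} → x ∈ p - y → x ≢ y
x∈p-y⇒x≢y {p = p} x∈ = x∉⁅y⁆⇒x≢y (x∈p─q⇒x∉q p _ x∈)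

p⊆q⇒p-x⊆q-x : ∀ {n} {p q : Subset n} {x} → p ⊆ q → p - x ⊆ q - x
p⊆q⇒p-x⊆q-x {p = p} p⊆q x∈ = x∈p∧x≢y⇒x∈p-y (p⊆q (p─q⊆p p _ x∈)) (x∈p-y⇒x≢y {p = p} x∈)

x∈p⇒⁅x⁆⊆p : ∀ {n} {x : Fin n} {p} → x ∈ p → ⁅ x ⁆ ⊆ p
x∈p⇒⁅x⁆⊆p {x = x} {p} x∈p y∈ = subst (_∈ p) (sym (x∈⁅y⁆⇒x≡y x y∈)) x∈p

∪-lub : ∀ {n} {p q r : Subset n} → p ⊆ r → q ⊆ r → p ∪ q ⊆ r
∪-lub {p = p} {q} p⊆r q⊆r x∈ with x∈p∪q⁻ p q x∈
... | inj₁ x∈p = p⊆r x∈p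
... | inj₂ x∈q = q⊆r x∈q

∣p∣<∣p∪⁅x⁆∣ : ∀ {n} {p : Subset n} {x} → x ∉ p → ∣ p ∣ < ∣ p ∪ ⁅ x ⁆ ∣
∣p∣<∣p∪⁅x⁆∣ {p = p} {x} x∉p = p⊂q⇒∣p∣<∣q∣ (p⊆p∪q ⁅ x ⁆ , x , q⊆p∪q p ⁅ x ⁆ (x∈⁅x⁆ x) , x∉p)

∣p∣≤0⇒p⊆⊥ : ∀ {n} {p : Subset n} → ∣ p ∣ ≤ 0 → p ⊆ ⊥
∣p∣≤0⇒p⊆⊥ {p = p} ∣p∣≤0 {x} x∈p = contradiction 1≤0 λ ()
  where
  1≤0 : 1 ≤ 0
  1≤0 = begin
    1          ≡⟨ sym (∣⁅x⁆∣≡1 x) ⟩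
    ∣ ⁅ x ⁆ ∣  ≤⟨ p⊆q⇒∣p∣≤∣q∣ (x∈p⇒⁅x⁆⊆p x∈p) ⟩
    ∣ p ∣      ≤⟨ ∣p∣≤0 ⟩
    0          ∎
    where open ≤-Reasoning

below : ∀ {n} → ℕ → Subset n
below {zero}  _       = []
below {suc n} zero    = ⊥
below {suc n} (suc t) = inside ∷ below t

∈below⁺ : ∀ {n} {i : Fin n} {t} → toℕ i < t → i ∈ below t
∈below⁺ {i = Fin.zero}  {suc t} _        = here
∈below⁺ {i = Fin.suc i} {suc t} (s≤s lt) = there (∈below⁺ lt)

∈below⁻ : ∀ {n} {i : Fin n} {t} → i ∈ below t → toℕ i < t
∈below⁻ {suc n} {t = zero}  i∈ = contradiction i∈ ∉⊥
∈below⁻ {i = Fin.zero}  {suc t} here      = s≤s z≤n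
∈below⁻ {i = Fin.suc i} {suc t} (there m) = s≤s (∈below⁻ m)

below-mono : ∀ {n} {t t′} → t ≤ t′ → below {n} t ⊆ below t′
below-mono t≤t′ i∈ = ∈below⁺ (<-≤-trans (∈below⁻ i∈) t≤t′)

below-suc : ∀ {n} (i : Fin n) → below (suc (toℕ i)) ⊆ ⁅ i ⁆ ∪ below (toℕ i)
below-suc i {l} l∈ with m<1+n⇒m<n∨m≡n (∈below⁻ l∈)
... | inj₁ l<i = q⊆p∪q ⁅ i ⁆ _ (∈below⁺ l<i)
... | inj₂ l≡i = p⊆p∪q (below (toℕ i)) (subst (_∈ ⁅ i ⁆) (sym (toℕ-injective l≡i)) (x∈⁅x⁆ i))

[p∪⁅x⁆]∪q-x⊆p∪q : ∀ {n} (p q : Subset n) x → ((p ∪ ⁅ x ⁆) ∪ q) - x ⊆ p ∪ q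
[p∪⁅x⁆]∪q-x⊆p∪q p q x {y} y∈ with x∈p∪q⁻ (p ∪ ⁅ x ⁆) q (p─q⊆p _ ⁅ x ⁆ y∈)
... | inj₂ y∈q = q⊆p∪q p q y∈q
... | inj₁ y∈p∪x with x∈p∪q⁻ p ⁅ x ⁆ y∈p∪x
...   | inj₁ y∈p = p⊆p∪q q y∈p
...   | inj₂ y∈x = contradiction (x∈⁅y⁆⇒x≡y x y∈x) (x∈p-y⇒x≢y {p = (p ∪ ⁅ x ⁆) ∪ q} y∈)

certificate-⊆ : ∀ {n} {f : Input n → Bool} {x S S′} → S ⊆ S′ →
                IsCertificate f x S → IsCertificate f x S′
certificate-⊆ S⊆S′ cert y agree = cert y (λ i i∈S → agree i (S⊆S′ i∈S))

module Subcube {n : ℕ} (x⋆ : Input n) (b : Bool) where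

  point : Subset n → Input n
  point T i = if does (i ∈? T) then x⋆ i else not b

  point-∈ : ∀ {T i} → i ∈ T → point T i ≡ x⋆ i
  point-∈ {T} {i} i∈T with i ∈? T
  ... | yes _   = refl
  ... | no i∉T = contradiction i∈T i∉T

  point-∉ : ∀ {T i} → i ∉ T → point T i ≡ not b
  point-∉ {T} {i} i∉T with i ∈? T
  ... | yes i∈T = contradiction i∈T i∉T
  ... | no _    = refl

  point-⊑-agreeing : ∀ {T y} → (∀ i → i ∈ T → y i ≡ x⋆ i) → point T ⊑[ b ] y
  point-⊑-agreeing {T} agree i with i ∈? T
  ... | yes i∈T = trans (agree i i∈T)
  ... | no _    = λ ¬b≡b → contradiction (sym ¬b≡b) (not-¬ refl)

  point-mono : ∀ {T T′} → T ⊆ T′ → point T ⊑[ b ] point T′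
  point-mono T⊆T′ = point-⊑-agreeing (λ i i∈T → point-∈ (T⊆T′ i∈T))

  point-remove : ∀ {T i l} → l ≢ i → point (T - i) l ≡ point T l
  point-remove {T} {i} {l} l≢i with l ∈? T
  ... | yes l∈T = point-∈ (x∈p∧x≢y⇒x∈p-y l∈T l≢i)
  ... | no l∉T  = point-∉ (l∉T ∘ p─q⊆p T ⁅ i ⁆)

  module _ (f : Input n → Bool) where

    Critical : Subset n → Subset n → Set
    Critical F T = ∀ {i} → i ∈ F → f (point (T - i)) ≢ b

    sensitive∈certificate : ∀ {T i S} → f (point T) ≡ b → f (point (T - i)) ≢ b →
                            IsCertificate f (point T) S → i ∈ S
    sensitive∈certificate {T} {i} {S} hit miss cert with i ∈? S
    ... | yes i∈S = i∈S
    ... | no i∉S  = contradiction (trans (cert (point (T - i)) agree) hit) miss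
      where
      agree : ∀ l → l ∈ S → point (T - i) l ≡ point T l
      agree l l∈S = point-remove (λ l≡i → i∉S (subst (_∈ S) l≡i l∈S))

    critical-size : ∀ {K F T} → CertComp≤ f K → f (point T) ≡ b → Critical F T → ∣ F ∣ ≤ K
    critical-size {T = T} cc hit critical =
      let (S , cert , ∣S∣≤K) = cc (point T)
      in ≤-trans (p⊆q⇒∣p∣≤∣q∣ (λ i∈F → sensitive∈certificate hit (critical i∈F) cert)) ∣S∣≤K

  module _ {f : Input n → Bool} (mono : Monotone f) where

    point-hit-mono : ∀ {T T′} → T ⊆ T′ → f (point T) ≡ b → f (point T′) ≡ b
    point-hit-mono T⊆T′ = monotone-preserves mono b (point-mono T⊆T′)

    point-certifies : ∀ {T} → f x⋆ ≡ b → f (point T) ≡ b → IsCertificate f x⋆ T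
    point-certifies hb hit y agree =
      trans (monotone-preserves mono b (point-⊑-agreeing agree) hit) (sym hb)

query-height : ∀ {n H} (y : Input n) {t : Bool → QTree n} →
               (∀ r → height (t r) ≤ H) → height (query y t) ≤ suc H
query-height _ h = s≤s (⊔-lub (h false) (h true))

module Bisection {n : ℕ} (b : Bool) where

  Threshold : (Input n → Bool) → (ℕ → Input n) → ℕ → Set
  Threshold f q s = f (q s) ≢ b × f (q (suc s)) ≡ b

  bisect : (ℕ → Input n) → ℕ → ℕ → (ℕ → QTree n) → QTree n
  bisect q zero    lo κ = κ lo
  bisect q (suc p) lo κ = query (q (lo + 2 ^ p)) λ r →
    if does (r ≟ᵇ b) then bisect q p lo κ else bisect q p (lo + 2 ^ p) κ

  bisect-height : ∀ q p lo κ {H} → (∀ s → height (κ s) ≤ H) → height (bisect q p lo κ) ≤ p + H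
  bisect-height q zero    lo κ hκ = hκ lo
  bisect-height q (suc p) lo κ {H} hκ = query-height (q (lo + 2 ^ p)) λ r → half (does (r ≟ᵇ b))
    where
    half : ∀ c → height (if c then bisect q p lo κ else bisect q p (lo + 2 ^ p) κ) ≤ p + H
    half true  = bisect-height q p lo κ hκ
    half false = bisect-height q p (lo + 2 ^ p) κ hκ

  bisect-run : ∀ f q p lo κ → f (q lo) ≢ b → f (q (lo + 2 ^ p)) ≡ b →
               ∃ λ s → Threshold f q s × run f (bisect q p lo κ) ≡ run f (κ s)
  bisect-run f q zero lo κ miss hit =
    lo , (miss , subst (λ t → f (q t) ≡ b) (+-comm lo 1) hit) , refl
  bisect-run f q (suc p) lo κ miss hit with f (q (lo + 2 ^ p)) ≟ᵇ b
  ... | yes hit′  = bisect-run f q p lo κ miss hit′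
  ... | no miss′ = bisect-run f q p (lo + 2 ^ p) κ miss′ (subst (λ t → f (q t) ≡ b) split hit)
    where
    split : lo + 2 ^ suc p ≡ lo + 2 ^ p + 2 ^ p
    split = begin
      lo + (2 ^ p + (2 ^ p + 0))  ≡⟨ cong (λ x → lo + (2 ^ p + x)) (+-identityʳ (2 ^ p)) ⟩
      lo + (2 ^ p + 2 ^ p)        ≡⟨ sym (+-assoc lo (2 ^ p) (2 ^ p)) ⟩
      lo + 2 ^ p + 2 ^ p          ∎
      where open ≡-Reasoning

module Greedy {n : ℕ} (x⋆ : Input n) (b : Bool) (L : ℕ) where
  open Subcube x⋆ b
  open Bisection {n} b

  probe : Subset n → ℕ → Input n
  probe F t = point (F ∪ below t)

  insert : ℕ → Subset n → Subset n
  insert s F with s <? n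
  ... | yes s<n = F ∪ ⁅ fromℕ< s<n ⁆
  ... | no _    = F

  insert-< : ∀ {s} F (s<n : s < n) → insert s F ≡ F ∪ ⁅ fromℕ< s<n ⁆
  insert-< {s} F s<n with s <? n
  ... | yes _    = refl
  ... | no s≮n = contradiction s<n s≮n

  grow : ℕ → Subset n → QTree n
  grow zero       F = leaf F
  grow (suc fuel) F = query (point F) λ r →
    if does (r ≟ᵇ b) then leaf F else bisect (probe F) L 0 (λ s → grow fuel (insert s F))

  grow-height : ∀ fuel F → height (grow fuel F) ≤ fuel * suc L
  grow-height zero       F = z≤n
  grow-height (suc fuel) F = query-height (point F) λ r → round (does (r ≟ᵇ b))
    where
    round : ∀ c → height (if c then leaf F else bisect (probe F) L 0 (λ s → grow fuel (insert s F)))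
                  ≤ L + fuel * suc L
    round true  = z≤n
    round false = bisect-height (probe F) L 0 _ (λ s → grow-height fuel (insert s F))

  module Correctness {f : Input n → Bool} (mono : Monotone f) (hb : f x⋆ ≡ b)
                     {K : ℕ} (cc : CertComp≤ f K) (hL : n ≤ 2 ^ L) where

    probe-mono : ∀ {F t t′} → t ≤ t′ → f (probe F t) ≡ b → f (probe F t′) ≡ b
    probe-mono {F} t≤t′ =
      point-hit-mono mono (∪-lub (p⊆p∪q _) (⊆-trans (below-mono t≤t′) (q⊆p∪q F _)))

    record Invariant (F : Subset n) (j : ℕ) : Set where
      field
        hit      : f (probe F j) ≡ b
        above    : ∀ {i} → i ∈ F → j ≤ toℕ i
        critical : Critical f F (F ∪ below j)
        bounded  : j ≤ n
    open Invariant

    start : Invariant ⊥ n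
    start = record
      { hit      = monotone-preserves mono b x⋆⊑probe hb
      ; above    = λ i∈⊥ → contradiction i∈⊥ ∉⊥
      ; critical = λ i∈⊥ → contradiction i∈⊥ ∉⊥
      ; bounded  = ≤-refl
      }
      where
      x⋆⊑probe : x⋆ ⊑[ b ] probe ⊥ n
      x⋆⊑probe i = trans (point-∈ (q⊆p∪q ⊥ (below n) (∈below⁺ (toℕ<n i))))

    module _ {F j} (inv : Invariant F j) where

      threshold<j : ∀ {s} → Threshold f (probe F) s → s < j
      threshold<j (miss , _) = ≰⇒> λ j≤s → miss (probe-mono j≤s (hit inv))

      threshold∉ : ∀ {i} → Threshold f (probe F) (toℕ i) → i ∉ F
      threshold∉ thr i∈F = <⇒≱ (threshold<j thr) (above inv i∈F)

      invariant-step : ∀ {i} → Threshold f (probe F) (toℕ i) → Invariant (F ∪ ⁅ i ⁆) (toℕ i)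
      invariant-step {i} thr@(miss , hit′) = record
        { hit      = point-hit-mono mono grown hit′
        ; above    = above′
        ; critical = critical′
        ; bounded  = <⇒≤ (toℕ<n i)
        }
        where
        i<j : toℕ i < j
        i<j = threshold<j thr

        grown : F ∪ below (suc (toℕ i)) ⊆ (F ∪ ⁅ i ⁆) ∪ below (toℕ i)
        grown = ∪-lub (⊆-trans (p⊆p∪q ⁅ i ⁆) (p⊆p∪q _))
                      (⊆-trans (below-suc i) (∪-lub (⊆-trans (q⊆p∪q F ⁅ i ⁆) (p⊆p∪q _)) (q⊆p∪q _ _)))

        shrunk : (F ∪ ⁅ i ⁆) ∪ below (toℕ i) ⊆ F ∪ below j
        shrunk = ∪-lub (∪-lub (p⊆p∪q _) (x∈p⇒⁅x⁆⊆p (q⊆p∪q F _ (∈below⁺ i<j))))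
                       (⊆-trans (below-mono (<⇒≤ i<j)) (q⊆p∪q F _))

        above′ : ∀ {l} → l ∈ F ∪ ⁅ i ⁆ → toℕ i ≤ toℕ l
        above′ l∈ with x∈p∪q⁻ F ⁅ i ⁆ l∈
        ... | inj₁ l∈F = <⇒≤ (<-≤-trans i<j (above inv l∈F))
        ... | inj₂ l∈i = ≤-reflexive (cong toℕ (sym (x∈⁅y⁆⇒x≡y i l∈i)))

        critical′ : Critical f (F ∪ ⁅ i ⁆) ((F ∪ ⁅ i ⁆) ∪ below (toℕ i))
        critical′ l∈ with x∈p∪q⁻ F ⁅ i ⁆ l∈
        ... | inj₁ l∈F = critical inv l∈F ∘ point-hit-mono mono (p⊆q⇒p-x⊆q-x shrunk)
        ... | inj₂ l∈i with x∈⁅y⁆⇒x≡y i l∈i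
        ...   | refl = miss ∘ point-hit-mono mono ([p∪⁅x⁆]∪q-x⊆p∪q F (below (toℕ i)) i)

    SmallCertificate : Subset n → Set
    SmallCertificate F = IsCertificate f x⋆ F × ∣ F ∣ ≤ K

    grow-correct : ∀ fuel {F j} → Invariant F j → suc K ≤ ∣ F ∣ + fuel →
                   SmallCertificate (run f (grow fuel F))
    grow-correct zero inv enough =
      contradiction (critical-size f cc (hit inv) (critical inv))
                    (<⇒≱ (≤-trans enough (≤-reflexive (+-identityʳ _))))
    grow-correct (suc fuel) {F} inv enough with f (point F) ≟ᵇ b
    ... | yes hitF = point-certifies mono hb hitF , critical-size f cc (hit inv) (critical inv)
    ... | no missF =
      let (s , thr , run≡) = bisect-run f (probe F) L 0 (λ s → grow fuel (insert s F))
                               (missF ∘ point-hit-mono mono empty-prefix)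
                               (probe-mono (≤-trans (bounded inv) hL) (hit inv))
      in subst SmallCertificate (sym run≡) (next thr)
      where
      empty-prefix : F ∪ below 0 ⊆ F
      empty-prefix = ∪-lub ⊆-refl (λ i∈ → contradiction (∈below⁻ i∈) λ ())

      next : ∀ {s} → Threshold f (probe F) s → SmallCertificate (run f (grow fuel (insert s F)))
      next {s} thr = subst (λ G → SmallCertificate (run f (grow fuel G))) (sym (insert-< F s<n))
                           (grow-correct fuel (invariant-step inv thr′) enough′)
        where
        s<n : s < n
        s<n = <-≤-trans (threshold<j inv thr) (bounded inv)
        thr′ : Threshold f (probe F) (toℕ (fromℕ< s<n))
        thr′ = subst (Threshold f (probe F)) (sym (toℕ-fromℕ< s<n)) thr
        enough′ : suc K ≤ ∣ F ∪ ⁅ fromℕ< s<n ⁆ ∣ + fuel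
        enough′ = begin
          suc K                          ≤⟨ enough ⟩
          ∣ F ∣ + suc fuel               ≡⟨ +-suc ∣ F ∣ fuel ⟩
          suc ∣ F ∣ + fuel               ≤⟨ +-monoˡ-≤ fuel (∣p∣<∣p∪⁅x⁆∣ (threshold∉ inv thr′)) ⟩
          ∣ F ∪ ⁅ fromℕ< s<n ⁆ ∣ + fuel  ∎
          where open ≤-Reasoning

    grow-certifies : SmallCertificate (run f (grow (suc K) ⊥))
    grow-certifies = grow-correct (suc K) start (m≤n+m (suc K) ∣ ⊥ {n} ∣)

certificate-tree : (n k : ℕ) → Input n → QTree n
-- C(f) ≤ 0 makes f constant, and the height bound 0 allows no query.
certificate-tree n zero    x⋆ = leaf ⊥
certificate-tree n (suc k) x⋆ = query x⋆ λ b → Greedy.grow x⋆ b ⌈log₂ n ⌉ (2 + k) ⊥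

3+k≤3*[1+k]^8 : ∀ k → 3 + k ≤ 3 * suc k ^ 8
3+k≤3*[1+k]^8 k = begin
  3 + k              ≤⟨ +-monoʳ-≤ 3 (m≤n*m k 3) ⟩
  3 + 3 * k          ≡⟨ *-suc 3 k ⟨
  3 * suc k          ≤⟨ *-monoʳ-≤ 3 (m≤m*n (suc k) (suc k ^ 7) {{m^n≢0 (suc k) 7}}) ⟩
  3 * suc k ^ 8      ∎
  where open ≤-Reasoning

certificate-tree-height : ∀ n k x⋆ → height (certificate-tree n k x⋆) ≤ 3 * k ^ 8 * (1 + ⌈log₂ n ⌉)
certificate-tree-height n zero    x⋆ = z≤n
certificate-tree-height n (suc k) x⋆ = begin
  height (certificate-tree n (suc k) x⋆)  ≤⟨ query-height x⋆ {t = grow} grow-height ⟩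
  1 + (2 + k) * suc L                     ≤⟨ +-monoˡ-≤ ((2 + k) * suc L) (s≤s z≤n) ⟩
  (3 + k) * suc L                         ≤⟨ *-monoˡ-≤ (suc L) (3+k≤3*[1+k]^8 k) ⟩
  3 * suc k ^ 8 * suc L                   ∎
  where
  L = ⌈log₂ n ⌉
  grow : Bool → QTree n
  grow b = Greedy.grow x⋆ b L (2 + k) ⊥
  grow-height : ∀ b → height (grow b) ≤ (2 + k) * suc L
  grow-height b = Greedy.grow-height x⋆ b L (2 + k) ⊥
  open ≤-Reasoning

certificate-tree-correct : ∀ n k x⋆ (f : Input n → Bool) → Monotone f → CertComp≤ f k →
                           IsCertificate f x⋆ (run f (certificate-tree n k x⋆)) ×
                           ∣ run f (certificate-tree n k x⋆) ∣ ≤ k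
certificate-tree-correct n zero x⋆ f mono cc =
  let (S , cert , ∣S∣≤0) = cc x⋆
  in certificate-⊆ (∣p∣≤0⇒p⊆⊥ ∣S∣≤0) cert , ≤-reflexive (∣⊥∣≡0 n)
certificate-tree-correct n (suc k) x⋆ f mono cc =
  Greedy.Correctness.grow-certifies x⋆ (f x⋆) ⌈log₂ n ⌉ mono refl cc (n≤2^⌈log₂n⌉ n)

theorem1 : ∃ λ (c : ℕ) → ∃ λ (d : ℕ) → 1 ≤ d ×
    (∀ (n k : ℕ) (x⋆ : Input n) →
      Σ ℕ λ m → Σ (Fin (suc m) → QTree n) λ A →
        (∀ r → height (A r) ≤ c * k ^ 8 * (1 + ⌈log₂ n ⌉)) ×
        (∀ (f : Input n → Bool) → Monotone f → CertComp≤ f k →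
          Σ (Subset (suc m)) λ B →
            ∣ B ∣ * n ^ d ≤ suc m ×
            (∀ r → r ∉ B →
              IsCertificate f x⋆ (run f (A r)) × ∣ run f (A r) ∣ ≤ k)))
theorem1 = 3 , 1 , ≤-refl , λ n k x⋆ →
  0 , (λ _ → certificate-tree n k x⋆) , (λ _ → certificate-tree-height n k x⋆) ,
  λ f mono cc → ⊥ , z≤n , λ _ _ → certificate-tree-correct n k x⋆ f mono cc
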